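{- Let $C\subseteq\mathbb{F}_2^{24}$ be a Type II code of length $24$. Then: (1) either $C_4=\emptyset$, or for each $i\in\{1,2,\dots,24\}$ there exists $c\in C_4$ with $c_i=1$; (2) each irreducible component of the tetrad subcode $\tau(C)$ has tetrad number equal to $|C_4|/24$.
   Context: A (binary linear) code of length $n$ is a linear subspace $C\subseteq\mathbb{F}_2^n$. For $c\in\mathbb{F}_2^n$, $\mathrm{wt}(c)=|\{i: c_i=1\}|$, and $C_w=\{c\in C:\mathrm{wt}(c)=w\}$. The dual code is $C^\perp=\{c'\in\mathbb{F}_2^n: \sum_i c_ic'_i=0 \text{ for all } c\in C\}$; $C$ is Type II if $C=C^\perp$ and $4\mid\mathrm{wt}(c)$ for all $c\in C$. The tetrad subcode $\tau(C)$ is the subcode generated by $C_4$. Irreducible components: partition the set of coordinates lying in the support of some word of $C_4$ into the classes of the equivalence relation generated by $i\sim j$ whenever some $c\in C_4$ has $c_i=c_j=1$; $\tau(C)$ is the direct sum of its projections onto these classes, and these projections (each a code of length $m$ equal to the size of its class) are the irreducible components. The tetrad number of an irreducible tetrad code $D$ of length $m$ is $\eta(D)=|D_4|/m$. -}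

module Defs where

open import Data.Bool using (Bool; true; false; _∧_; _xor_; if_then_else_)
open import Data.Nat using (ℕ; zero; suc; _+_; _*_; _≡ᵇ_)
open import Data.Nat.Divisibility using (_∣_)
open import Data.Fin using (Fin)
open import Data.Vec using (Vec; []; _∷_; lookup; replicate; zipWith; foldr)
open import Data.List using (List; []; _∷_; _++_; map)
open import Data.Product using (Σ; _×_; _,_; ∃)
open import Function.Bundles using (_⇔_)
open import Relation.Binary.PropositionalEquality using (_≡_)
open import Relation.Binary.Construct.Closure.Equivalence using (EqClosure)

-- Words of F_2^n, with F_2 = Bool (true = 1, xor = addition, ∧ = multiplication)
Word : ℕ → Set
Word n = Vec Bool n

zeroW : ∀ {n} → Word n
zeroW = replicate _ false

_⊕_ : ∀ {n} → Word n → Word n → Word n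
_⊕_ = zipWith _xor_

wt : ∀ {n} → Word n → ℕ
wt [] = 0
wt (true ∷ v) = suc (wt v)
wt (false ∷ v) = wt v

dot : ∀ {n} → Word n → Word n → Bool
dot x y = foldr _ _xor_ false (zipWith _∧_ x y)

eqW : ∀ {n} → Word n → Word n → Bool
eqW [] [] = true
eqW (true ∷ x) (true ∷ y) = eqW x y
eqW (false ∷ x) (false ∷ y) = eqW x y
eqW _ _ = false

allWords : (n : ℕ) → List (Word n)
allWords zero = [] ∷ []
allWords (suc n) = map (false ∷_) (allWords n) ++ map (true ∷_) (allWords n)

countL : ∀ {A : Set} → (A → Bool) → List A → ℕ
countL p [] = 0
countL p (x ∷ xs) = if p x then suc (countL p xs) else countL p xs

anyL : ∀ {A : Set} → (A → Bool) → List A → Bool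
anyL p [] = false
anyL p (x ∷ xs) = if p x then true else anyL p xs

filterL : ∀ {A : Set} → (A → Bool) → List A → List A
filterL p [] = []
filterL p (x ∷ xs) = if p x then x ∷ filterL p xs else filterL p xs

-- A code of length n: a subset of F_2^n given by its characteristic function
Code : ℕ → Set
Code n = Word n → Bool

IsLinear : ∀ {n} → Code n → Set
IsLinear C = (C zeroW ≡ true) × (∀ x y → C x ≡ true → C y ≡ true → C (x ⊕ y) ≡ true)

InDual : ∀ {n} → Code n → Word n → Set
InDual C x = ∀ y → C y ≡ true → dot x y ≡ false

SelfDual : ∀ {n} → Code n → Set
SelfDual C = ∀ x → (C x ≡ true) ⇔ InDual C x

IsTypeII : ∀ {n} → Code n → Set
IsTypeII C = IsLinear C × SelfDual C × (∀ x → C x ≡ true → 4 ∣ wt x)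

isC4 : ∀ {n} → Code n → Word n → Bool
isC4 C x = C x ∧ (wt x ≡ᵇ 4)

C4list : ∀ {n} → Code n → List (Word n)
C4list {n} C = filterL (isC4 C) (allWords n)

numC4 : ∀ {n} → Code n → ℕ
numC4 {n} C = countL (isC4 C) (allWords n)

-- F_2-span of a list of words (as a list, possibly with repetitions)
spanL : ∀ {n} → List (Word n) → List (Word n)
spanL [] = zeroW ∷ []
spanL (g ∷ gs) = spanL gs ++ map (g ⊕_) (spanL gs)

inTau : ∀ {n} → Code n → Word n → Bool
inTau C x = anyL (eqW x) (spanL (C4list C))

Adj : ∀ {n} → Code n → Fin n → Fin n → Set
Adj {n} C i j = Σ (Word n) λ c → (isC4 C c ≡ true) × (lookup c i ≡ true) × (lookup c j ≡ true)

-- S (a set of coordinates, as a bit vector) is an irreducible class: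
-- the equivalence class of some coordinate i lying in the support of C_4
-- under the equivalence relation generated by Adj
IsComponentClass : ∀ {n} → Code n → Vec Bool n → Set
IsComponentClass {n} C S =
  Σ (Fin n) λ i → Adj C i i × (∀ j → (lookup S j ≡ true) ⇔ EqClosure (Adj C) i j)

-- restriction of a word to the coordinates in S (zero outside S);
-- words of length n supported in S are identified with words of length |S|
restrict : ∀ {n} → Vec Bool n → Word n → Word n
restrict S c = zipWith _∧_ S c

-- membership in the irreducible component D = projection of τ(C) onto S
inComp : ∀ {n} → Code n → Vec Bool n → Word n → Bool
inComp {n} C S w = anyL (λ c → inTau C c ∧ eqW (restrict S c) w) (allWords n)

numComp4 : ∀ {n} → Code n → Vec Bool n → ℕ
numComp4 {n} C S = countL (λ w → inComp C S w ∧ (wt w ≡ᵇ 4)) (allWords n)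

-- The tetrads of a Type II code C of length 24 form a 1-design: |C₄| = 6 N_i, where N_i counts
-- the tetrads through coordinate i. To see this, twist the indicator of C by the sign (-1)^{c_i}.
-- Self-duality turns the sum of this twisted indicator against the Krawtchouk sum K_k into |C|
-- times the number of codewords at distance k from the unit vector e_i, which is 1 for k = 1 and
-- N_i for k = 3 because no codeword has weight 2. In the balance x = 24 - 2 wt(c) one has
-- 6(K_1 + K_3) = x(x - 8)(x + 8), which vanishes on the doubly even weights 8, 12, 16 and is odd
-- under complementation (1 ∈ C), so only the weights 0 and 4 contribute; together with |C| = 2¹²
-- this gives a linear equation forcing |C₄| = 6 N_i. For part (2), a
-- tetrad meeting a component class S lies inside it, so τ(C) projects into C, the weight-4 words
-- of the component are exactly the tetrads inside S, and summing N_j = |C₄|/6 over j ∈ S counts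
-- each of them four times.

module Submission where

open import Defs
open import Algebra.Bundles using (CommutativeRing)
open import Data.Bool using (Bool; true; false; _∧_; _xor_; not)
open import Data.Bool.Properties
  using (∧-assoc; ∧-comm; ∧-zeroʳ; ∧-identityʳ; ∧-idem; ∧-distribˡ-xor; ∧-distribʳ-xor;
         xor-assoc; xor-comm; xor-same; xor-identityʳ; not-involutive; xor-∧-commutativeRing; T-≡)
open import Data.Empty using (⊥-elim)
open import Data.Fin using (Fin; zero; suc)
open import Data.List using (List; []; _∷_; _++_; map)
open import Data.List.Membership.Propositional using (_∈_)
open import Data.List.Membership.Propositional.Properties using (∈-map⁺; ∈-map⁻; ∈-++⁺ˡ; ∈-++⁺ʳ; ∈-++⁻)
open import Data.List.Relation.Unary.Any using (here; there)
open import Data.Nat as ℕ using (ℕ; zero; suc; _∸_; _≤_; z≤n; s≤s)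
import Data.Nat.Properties as ℕ
open import Data.Nat.Divisibility using (_∣_; divides; ∣-trans; ∣⇒≤)
open import Data.Product using (Σ; _×_; _,_; proj₁; proj₂)
open import Function.Bundles using (Equivalence; _⇔_)
open import Data.Sum using (_⊎_; inj₁; inj₂)
open import Data.Vec as Vec using (Vec; []; _∷_; lookup; replicate)
open import Data.Vec.Properties
  using (zipWith-assoc; zipWith-idem; zipWith-identityʳ; zipWith-zeroʳ; zipWith-distribˡ; lookup-zipWith)
open import Relation.Binary.Definitions using (tri<; tri≈; tri>)
open import Relation.Binary.PropositionalEquality using (_≡_; _≢_; refl; sym; trans; cong; cong₂; subst; module ≡-Reasoning)
open import Relation.Binary.Construct.Closure.Equivalence using (EqClosure)
open import Relation.Binary.Construct.Closure.ReflexiveTransitive using (ε; _◅_; _◅◅_)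
open import Relation.Binary.Construct.Closure.Symmetric using (fwd)
open import Relation.Nullary using (¬_; Dec; yes; no)
open import Algebra.Properties.CommutativeSemigroup
  (CommutativeRing.+-commutativeSemigroup xor-∧-commutativeRing)
  using () renaming (interchange to xor-interchange)

∧-true : ∀ {a b} → a ∧ b ≡ true → a ≡ true × b ≡ true
∧-true {true} {true} _ = refl , refl

≡true-ext : ∀ {a b : Bool} → (a ≡ true → b ≡ true) → (b ≡ true → a ≡ true) → a ≡ b
≡true-ext {true} {true} _ _ = refl
≡true-ext {false} {false} _ _ = refl
≡true-ext {true} {false} a⇒b _ = sym (a⇒b refl)
≡true-ext {false} {true} _ b⇒a = b⇒a refl

parity : ℕ → Bool
parity zero = false
parity (suc m) = not (parity m)

parity-even : ∀ m → 2 ∣ m → parity m ≡ false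
parity-even _ (divides q refl) = parity-double q
  where
  parity-double : ∀ q → parity (q ℕ.* 2) ≡ false
  parity-double zero = refl
  parity-double (suc q) = trans (not-involutive _) (parity-double q)

≢⇒≡ᵇ-false : ∀ m n → m ≢ n → (m ℕ.≡ᵇ n) ≡ false
≢⇒≡ᵇ-false m n m≢n with m ℕ.≡ᵇ n in eq
... | false = refl
... | true = ⊥-elim (m≢n (ℕ.≡ᵇ⇒≡ m n (Equivalence.from T-≡ eq)))

square-injective : ∀ m n → m ℕ.* m ≡ n ℕ.* n → m ≡ n
square-injective m n m²≡n² with ℕ.<-cmp m n
... | tri< m<n _ _ = ⊥-elim (ℕ.<-irrefl m²≡n² (ℕ.*-mono-< m<n m<n))
... | tri≈ _ m≡n _ = m≡n
... | tri> _ _ n<m = ⊥-elim (ℕ.<-irrefl (sym m²≡n²) (ℕ.*-mono-< n<m n<m))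

unit : ∀ {n} → Fin n → Word n
unit zero = true ∷ zeroW
unit (suc i) = false ∷ unit i

ones : ∀ {n} → Word n
ones = replicate _ true

⊕-identityʳ : ∀ {n} (x : Word n) → x ⊕ zeroW ≡ x
⊕-identityʳ = zipWith-identityʳ xor-identityʳ

⊕-comm : ∀ {n} (x y : Word n) → x ⊕ y ≡ y ⊕ x
⊕-comm [] [] = refl
⊕-comm (a ∷ x) (b ∷ y) = cong₂ _∷_ (xor-comm a b) (⊕-comm x y)

⊕-cancelʳ : ∀ {n} (x y : Word n) → (x ⊕ y) ⊕ y ≡ x
⊕-cancelʳ [] [] = refl
⊕-cancelʳ (a ∷ x) (b ∷ y) =
  cong₂ _∷_ (trans (xor-assoc a b b) (trans (cong (a xor_) (xor-same b)) (xor-identityʳ a))) (⊕-cancelʳ x y)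

lookup-⊕-ones : ∀ {n} (c : Word n) i → lookup (c ⊕ ones) i ≡ not (lookup c i)
lookup-⊕-ones (true ∷ c) zero = refl
lookup-⊕-ones (false ∷ c) zero = refl
lookup-⊕-ones (_ ∷ c) (suc i) = lookup-⊕-ones c i

lookup-zeroW : ∀ {n} (i : Fin n) → lookup (zeroW {n}) i ≡ false
lookup-zeroW zero = refl
lookup-zeroW (suc i) = lookup-zeroW i

dot-⊕ˡ : ∀ {n} (x y z : Word n) → dot (x ⊕ y) z ≡ dot x z xor dot y z
dot-⊕ˡ [] [] [] = refl
dot-⊕ˡ (a ∷ x) (b ∷ y) (c ∷ z) =
  trans (cong₂ _xor_ (∧-distribʳ-xor c a b) (dot-⊕ˡ x y z)) (xor-interchange (a ∧ c) (b ∧ c) (dot x z) (dot y z))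

dot-comm : ∀ {n} (x y : Word n) → dot x y ≡ dot y x
dot-comm [] [] = refl
dot-comm (a ∷ x) (b ∷ y) = cong₂ _xor_ (∧-comm a b) (dot-comm x y)

dot-zeroʳ : ∀ {n} (x : Word n) → dot x zeroW ≡ false
dot-zeroʳ [] = refl
dot-zeroʳ (a ∷ x) = cong₂ _xor_ (∧-zeroʳ a) (dot-zeroʳ x)

dot-unitʳ : ∀ {n} (c : Word n) (i : Fin n) → dot c (unit i) ≡ lookup c i
dot-unitʳ (a ∷ c) zero = trans (cong₂ _xor_ (∧-identityʳ a) (dot-zeroʳ c)) (xor-identityʳ a)
dot-unitʳ (a ∷ c) (suc i) = cong₂ _xor_ (∧-zeroʳ a) (dot-unitʳ c i)

dot-unit-⊕ : ∀ {n} (c x : Word n) (i : Fin n) → dot c (unit i ⊕ x) ≡ lookup c i xor dot c x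
dot-unit-⊕ c x i =
  trans (dot-comm c (unit i ⊕ x))
    (trans (dot-⊕ˡ (unit i) x c) (cong₂ _xor_ (trans (dot-comm (unit i) c) (dot-unitʳ c i)) (dot-comm x c)))

dot-onesˡ : ∀ {n} (y : Word n) → dot ones y ≡ parity (wt y)
dot-onesˡ [] = refl
dot-onesˡ (true ∷ y) = cong not (dot-onesˡ y)
dot-onesˡ (false ∷ y) = dot-onesˡ y

wt≤n : ∀ {n} (c : Word n) → wt c ≤ n
wt≤n [] = z≤n
wt≤n (true ∷ c) = s≤s (wt≤n c)
wt≤n (false ∷ c) = ℕ.m≤n⇒m≤1+n (wt≤n c)

wt≡ᵇ0⇒zeroW : ∀ {n} (c : Word n) → (wt c ℕ.≡ᵇ 0) ≡ true → c ≡ zeroW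
wt≡ᵇ0⇒zeroW [] _ = refl
wt≡ᵇ0⇒zeroW (false ∷ c) w≡0 = cong (false ∷_) (wt≡ᵇ0⇒zeroW c w≡0)

wt-zeroW : ∀ n → wt (zeroW {n}) ≡ 0
wt-zeroW zero = refl
wt-zeroW (suc n) = wt-zeroW n

wt-⊕-ones : ∀ {n} (c : Word n) → wt (c ⊕ ones) ≡ n ∸ wt c
wt-⊕-ones [] = refl
wt-⊕-ones (true ∷ c) = wt-⊕-ones c
wt-⊕-ones (false ∷ c) = trans (cong suc (wt-⊕-ones c)) (sym (ℕ.+-∸-assoc 1 (wt≤n c)))

wt-⊕-unit : ∀ {n} (c : Word n) (i : Fin n) →
  (lookup c i ≡ true × wt c ≡ suc (wt (c ⊕ unit i))) ⊎ (lookup c i ≡ false × wt (c ⊕ unit i) ≡ suc (wt c))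
wt-⊕-unit (true ∷ c) zero = inj₁ (refl , cong (λ x → suc (wt x)) (sym (⊕-identityʳ c)))
wt-⊕-unit (false ∷ c) zero = inj₂ (refl , cong (λ x → suc (wt x)) (⊕-identityʳ c))
wt-⊕-unit (true ∷ c) (suc i) with wt-⊕-unit c i
... | inj₁ (cᵢ , w≡) = inj₁ (cᵢ , cong suc w≡)
... | inj₂ (cᵢ , w≡) = inj₂ (cᵢ , cong suc w≡)
wt-⊕-unit (false ∷ c) (suc i) = wt-⊕-unit c i

restrict-zeroW : ∀ {n} (S : Vec Bool n) → restrict S zeroW ≡ zeroW
restrict-zeroW = zipWith-zeroʳ ∧-zeroʳ

restrict-⊕ : ∀ {n} (S x y : Word n) → restrict S (x ⊕ y) ≡ restrict S x ⊕ restrict S y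
restrict-⊕ = zipWith-distribˡ ∧-distribˡ-xor

restrict-idem : ∀ {n} (S x : Word n) → restrict S (restrict S x) ≡ restrict S x
restrict-idem S x = trans (sym (zipWith-assoc ∧-assoc S S x)) (cong (λ T → restrict T x) (zipWith-idem ∧-idem S))

restrict-disjoint-or-meets : ∀ {n} (S c : Word n) →
  restrict S c ≡ zeroW ⊎ Σ (Fin n) (λ j → lookup S j ≡ true × lookup c j ≡ true)
restrict-disjoint-or-meets [] [] = inj₁ refl
restrict-disjoint-or-meets (true ∷ S) (true ∷ c) = inj₂ (zero , refl , refl)
restrict-disjoint-or-meets (true ∷ S) (false ∷ c) with restrict-disjoint-or-meets S c
... | inj₁ disjoint = inj₁ (cong (false ∷_) disjoint)
... | inj₂ (j , Sⱼ , cⱼ) = inj₂ (suc j , Sⱼ , cⱼ)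
restrict-disjoint-or-meets (false ∷ S) (_ ∷ c) with restrict-disjoint-or-meets S c
... | inj₁ disjoint = inj₁ (cong (false ∷_) disjoint)
... | inj₂ (j , Sⱼ , cⱼ) = inj₂ (suc j , Sⱼ , cⱼ)

restrict-⊆ : ∀ {n} (S c : Word n) → (∀ k → lookup c k ≡ true → lookup S k ≡ true) → restrict S c ≡ c
restrict-⊆ [] [] _ = refl
restrict-⊆ (a ∷ S) (true ∷ c) c⊆S = cong₂ _∷_ (trans (∧-identityʳ a) (c⊆S zero refl)) (restrict-⊆ S c (λ k → c⊆S (suc k)))
restrict-⊆ (a ∷ S) (false ∷ c) c⊆S = cong₂ _∷_ (∧-zeroʳ a) (restrict-⊆ S c (λ k → c⊆S (suc k)))

eqW⇒≡ : ∀ {n} (x y : Word n) → eqW x y ≡ true → x ≡ y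
eqW⇒≡ [] [] _ = refl
eqW⇒≡ (true ∷ x) (true ∷ y) eq = cong (true ∷_) (eqW⇒≡ x y eq)
eqW⇒≡ (false ∷ x) (false ∷ y) eq = cong (false ∷_) (eqW⇒≡ x y eq)

eqW-refl : ∀ {n} (x : Word n) → eqW x x ≡ true
eqW-refl [] = refl
eqW-refl (true ∷ x) = eqW-refl x
eqW-refl (false ∷ x) = eqW-refl x

eqW-zeroW : ∀ {n} (c : Word n) → (wt c ℕ.≡ᵇ 0) ≡ false → eqW zeroW c ≡ false
eqW-zeroW (true ∷ c) _ = refl
eqW-zeroW (false ∷ c) w≢0 = eqW-zeroW c w≢0

allWords-complete : ∀ {n} (c : Word n) → c ∈ allWords n
allWords-complete [] = here refl
allWords-complete {suc n} (false ∷ c) = ∈-++⁺ˡ (∈-map⁺ (false ∷_) (allWords-complete c))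
allWords-complete {suc n} (true ∷ c) = ∈-++⁺ʳ (map (false ∷_) (allWords n)) (∈-map⁺ (true ∷_) (allWords-complete c))

module _ {A : Set} (p : A → Bool) where

  anyL⁺ : ∀ {x} xs → x ∈ xs → p x ≡ true → anyL p xs ≡ true
  anyL⁺ (y ∷ xs) (here refl) px rewrite px = refl
  anyL⁺ (y ∷ xs) (there x∈xs) px with p y
  ... | true = refl
  ... | false = anyL⁺ xs x∈xs px

  anyL⁻ : ∀ xs → anyL p xs ≡ true → Σ A (λ x → x ∈ xs × p x ≡ true)
  anyL⁻ (y ∷ xs) any with p y in py
  ... | true = y , here refl , py
  ... | false with anyL⁻ xs any
  ...   | x , x∈xs , px = x , there x∈xs , px

  filterL⁺ : ∀ {x} xs → x ∈ xs → p x ≡ true → x ∈ filterL p xs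
  filterL⁺ (y ∷ xs) (here refl) px rewrite px = here refl
  filterL⁺ (y ∷ xs) (there x∈xs) px with p y
  ... | true = there (filterL⁺ xs x∈xs px)
  ... | false = filterL⁺ xs x∈xs px

  filterL⁻ : ∀ {x} xs → x ∈ filterL p xs → p x ≡ true
  filterL⁻ (y ∷ xs) x∈ with p y in py
  filterL⁻ (y ∷ xs) (here refl) | true = py
  filterL⁻ (y ∷ xs) (there x∈) | true = filterL⁻ xs x∈
  ... | false = filterL⁻ xs x∈

  countL≢0 : ∀ {x} xs → x ∈ xs → p x ≡ true → countL p xs ≢ 0
  countL≢0 (y ∷ xs) (here refl) px rewrite px = λ ()
  countL≢0 (y ∷ xs) (there x∈xs) px with p y
  ... | true = λ ()
  ... | false = countL≢0 xs x∈xs px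

  countL≢0⇒witness : ∀ xs → countL p xs ≢ 0 → Σ A (λ x → p x ≡ true)
  countL≢0⇒witness [] count≢0 = ⊥-elim (count≢0 refl)
  countL≢0⇒witness (x ∷ xs) count≢0 with p x in px
  ... | true = x , px
  ... | false = countL≢0⇒witness xs count≢0

  countL-++ : ∀ xs ys → countL p (xs ++ ys) ≡ countL p xs ℕ.+ countL p ys
  countL-++ [] ys = refl
  countL-++ (x ∷ xs) ys with p x
  ... | true = cong suc (countL-++ xs ys)
  ... | false = countL-++ xs ys

countL-map : ∀ {A B : Set} (p : B → Bool) (f : A → B) xs → countL p (map f xs) ≡ countL (λ x → p (f x)) xs
countL-map p f [] = refl
countL-map p f (x ∷ xs) with p (f x)
... | true = cong suc (countL-map p f xs)
... | false = countL-map p f xs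

countL-cong : ∀ {A : Set} {p q : A → Bool} → (∀ x → p x ≡ q x) → ∀ xs → countL p xs ≡ countL q xs
countL-cong p≗q [] = refl
countL-cong {p = p} {q} p≗q (x ∷ xs) rewrite p≗q x | countL-cong p≗q xs = refl

zeroW∈span : ∀ {n} (gs : List (Word n)) → zeroW ∈ spanL gs
zeroW∈span [] = here refl
zeroW∈span (g ∷ gs) = ∈-++⁺ˡ (zeroW∈span gs)

∈⇒∈span : ∀ {n} {g : Word n} gs → g ∈ gs → g ∈ spanL gs
∈⇒∈span {g = g} (g ∷ gs) (here refl) =
  ∈-++⁺ʳ (spanL gs) (subst (_∈ map (g ⊕_) (spanL gs)) (⊕-identityʳ g) (∈-map⁺ (g ⊕_) (zeroW∈span gs)))
∈⇒∈span (_ ∷ gs) (there g∈gs) = ∈-++⁺ˡ (∈⇒∈span gs g∈gs)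

module _ {n} (C : Code n) (linear : IsLinear C) (S : Vec Bool n) where

  restrict-span : ∀ gs → (∀ g → g ∈ gs → C (restrict S g) ≡ true) → ∀ v → v ∈ spanL gs → C (restrict S v) ≡ true
  restrict-span [] _ v (here refl) = subst (λ z → C z ≡ true) (sym (restrict-zeroW S)) (proj₁ linear)
  restrict-span (g ∷ gs) gens v v∈ with ∈-++⁻ (spanL gs) v∈
  ... | inj₁ v∈′ = restrict-span gs (λ g′ g′∈ → gens g′ (there g′∈)) v v∈′
  ... | inj₂ v∈g⊕ with ∈-map⁻ (g ⊕_) v∈g⊕
  ...   | u , u∈ , refl =
    subst (λ z → C z ≡ true) (sym (restrict-⊕ S g u))
      (proj₂ linear _ _ (gens g (here refl)) (restrict-span gs (λ g′ g′∈ → gens g′ (there g′∈)) u u∈))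

-- The integer operators are opened only inside this block, so that _*_ in the statement at the end
-- is multiplication on ℕ.
module _ where

  open import Data.Integer using (ℤ; +_; -_; _+_; _*_; _-_; _^_)
  import Data.Integer.Properties as ℤ
  open import Data.Integer.Tactic.RingSolver using (solve-∀)
  open import Algebra.Properties.Semiring.Sum ℤ.+-*-semiring
    using (sum; ∑-distrib-+; *-distribˡ-sum; *-distribʳ-sum; sum-cong-≗)
  open ≡-Reasoning

  ind : Bool → ℤ
  ind true = + 1
  ind false = + 0

  sgn : Bool → ℤ
  sgn false = + 1
  sgn true = - + 1

  ind-∧ : ∀ a b → ind (a ∧ b) ≡ ind a * ind b
  ind-∧ true true = refl
  ind-∧ true false = refl
  ind-∧ false _ = refl

  sgn-xor : ∀ a b → sgn (a xor b) ≡ sgn a * sgn b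
  sgn-xor true true = refl
  sgn-xor true false = refl
  sgn-xor false true = refl
  sgn-xor false false = refl

  sgn-not : ∀ a → sgn (not a) ≡ - sgn a
  sgn-not true = refl
  sgn-not false = refl

  self-negation : ∀ x → x ≡ - x → x ≡ + 0
  self-negation (+ zero) _ = refl

  ∑-ind-lookup : ∀ {n} (x : Word n) → sum (λ j → ind (lookup x j)) ≡ + wt x
  ∑-ind-lookup [] = refl
  ∑-ind-lookup (true ∷ x) = cong (λ s → + 1 + s) (∑-ind-lookup x)
  ∑-ind-lookup (false ∷ x) = trans (ℤ.+-identityˡ _) (∑-ind-lookup x)

  -- Opaque so that no conversion check ever unfolds a sum over the 2²⁴ words of length 24.
  opaque

    sumW : (n : ℕ) → (Word n → ℤ) → ℤ
    sumW zero f = f []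
    sumW (suc n) f = sumW n (λ c → f (false ∷ c)) + sumW n (λ c → f (true ∷ c))

    sumW-[] : (f : Word 0 → ℤ) → sumW 0 f ≡ f []
    sumW-[] f = refl

    sumW-∷ : ∀ n (f : Word (suc n) → ℤ) → sumW (suc n) f ≡ sumW n (λ c → f (false ∷ c)) + sumW n (λ c → f (true ∷ c))
    sumW-∷ n f = refl

    sumW-cong : ∀ n {f g : Word n → ℤ} → (∀ c → f c ≡ g c) → sumW n f ≡ sumW n g
    sumW-cong zero f≗g = f≗g []
    sumW-cong (suc n) f≗g = cong₂ _+_ (sumW-cong n (λ c → f≗g (false ∷ c))) (sumW-cong n (λ c → f≗g (true ∷ c)))

    sumW-+ : ∀ n (f g : Word n → ℤ) → sumW n (λ c → f c + g c) ≡ sumW n f + sumW n g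
    sumW-+ zero f g = refl
    sumW-+ (suc n) f g =
      trans (cong₂ _+_ (sumW-+ n f₀ g₀) (sumW-+ n f₁ g₁)) (interchange (sumW n f₀) (sumW n g₀) (sumW n f₁) (sumW n g₁))
      where
      f₀ f₁ g₀ g₁ : Word n → ℤ
      f₀ c = f (false ∷ c)
      f₁ c = f (true ∷ c)
      g₀ c = g (false ∷ c)
      g₁ c = g (true ∷ c)
      interchange : ∀ a b c d → (a + b) + (c + d) ≡ (a + c) + (b + d)
      interchange = solve-∀

    sumW-* : ∀ n a (f : Word n → ℤ) → sumW n (λ c → a * f c) ≡ a * sumW n f
    sumW-* zero a f = refl
    sumW-* (suc n) a f =
      trans (cong₂ _+_ (sumW-* n a (λ c → f (false ∷ c))) (sumW-* n a (λ c → f (true ∷ c))))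
            (sym (ℤ.*-distribˡ-+ a (sumW n (λ c → f (false ∷ c))) (sumW n (λ c → f (true ∷ c)))))

    sumW-neg : ∀ n (f : Word n → ℤ) → sumW n (λ c → - f c) ≡ - sumW n f
    sumW-neg zero f = refl
    sumW-neg (suc n) f =
      trans (cong₂ _+_ (sumW-neg n (λ c → f (false ∷ c))) (sumW-neg n (λ c → f (true ∷ c))))
            (sym (ℤ.neg-distrib-+ (sumW n (λ c → f (false ∷ c))) (sumW n (λ c → f (true ∷ c)))))

    sumW-⊕ : ∀ n (y : Word n) (f : Word n → ℤ) → sumW n f ≡ sumW n (λ c → f (c ⊕ y))
    sumW-⊕ zero [] f = refl
    sumW-⊕ (suc n) (false ∷ y) f =
      cong₂ _+_ (sumW-⊕ n y (λ c → f (false ∷ c))) (sumW-⊕ n y (λ c → f (true ∷ c)))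
    sumW-⊕ (suc n) (true ∷ y) f =
      trans (ℤ.+-comm (sumW n (λ c → f (false ∷ c))) (sumW n (λ c → f (true ∷ c))))
            (cong₂ _+_ (sumW-⊕ n y (λ c → f (true ∷ c))) (sumW-⊕ n y (λ c → f (false ∷ c))))

    sumW-swap : ∀ n m (g : Word n → Word m → ℤ) → sumW n (λ c → sumW m (g c)) ≡ sumW m (λ x → sumW n (λ c → g c x))
    sumW-swap zero m g = refl
    sumW-swap (suc n) m g =
      trans (cong₂ _+_ (sumW-swap n m (λ c → g (false ∷ c))) (sumW-swap n m (λ c → g (true ∷ c))))
            (sym (sumW-+ m (λ x → sumW n (λ c → g (false ∷ c) x)) (λ x → sumW n (λ c → g (true ∷ c) x))))

    sumW-∑ : ∀ n m (g : Word n → Fin m → ℤ) → sumW n (λ c → sum (g c)) ≡ sum (λ j → sumW n (λ c → g c j))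
    sumW-∑ zero m g = refl
    sumW-∑ (suc n) m g =
      trans (cong₂ _+_ (sumW-∑ n m (λ c → g (false ∷ c))) (sumW-∑ n m (λ c → g (true ∷ c))))
            (sym (∑-distrib-+ (λ j → sumW n (λ c → g (false ∷ c) j)) (λ j → sumW n (λ c → g (true ∷ c) j))))

  sumW-0 : ∀ n → sumW n (λ _ → + 0) ≡ + 0
  sumW-0 n = sumW-* n (+ 0) (λ _ → + 0)

  sumW-- : ∀ n (f g : Word n → ℤ) → sumW n (λ c → f c - g c) ≡ sumW n f - sumW n g
  sumW-- n f g = trans (sumW-+ n f (λ c → - g c)) (cong (λ s → sumW n f + s) (sumW-neg n g))

  sumW-count : ∀ n (p : Word n → Bool) → + countL p (allWords n) ≡ sumW n (λ c → ind (p c))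
  sumW-count zero p = sym (trans (sumW-[] _) (ind-count (p [])))
    where
    ind-count : ∀ b → ind b ≡ + countL (λ (_ : Word 0) → b) (Vec.[] ∷ [])
    ind-count true = refl
    ind-count false = refl
  sumW-count (suc n) p = begin
      + countL p (map (false ∷_) (allWords n) ++ map (true ∷_) (allWords n))
    ≡⟨ cong +_ (countL-++ p (map (false ∷_) (allWords n)) _) ⟩
      + (countL p (map (false ∷_) (allWords n)) ℕ.+ countL p (map (true ∷_) (allWords n)))
    ≡⟨ cong₂ (λ a b → + (a ℕ.+ b)) (countL-map p (false ∷_) (allWords n)) (countL-map p (true ∷_) (allWords n)) ⟩
      + countL (λ c → p (false ∷ c)) (allWords n) + + countL (λ c → p (true ∷ c)) (allWords n)
    ≡⟨ cong₂ _+_ (sumW-count n (λ c → p (false ∷ c))) (sumW-count n (λ c → p (true ∷ c))) ⟩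
      sumW n (λ c → ind (p (false ∷ c))) + sumW n (λ c → ind (p (true ∷ c)))
    ≡⟨ sym (sumW-∷ n _) ⟩
      sumW (suc n) (λ c → ind (p c))
    ∎

  ∑-wt≡0 : ∀ n → sumW n (λ c → ind (wt c ℕ.≡ᵇ 0)) ≡ + 1
  ∑-wt≡0 zero = sumW-[] _
  ∑-wt≡0 (suc n) = trans (sumW-∷ n _) (cong₂ _+_ (∑-wt≡0 n) (sumW-0 n))

  ∑-sgn-dot : ∀ {n} (c : Word n) → sumW n (λ x → sgn (dot c x)) ≡ ind (wt c ℕ.≡ᵇ 0) * (+ 2) ^ n
  ∑-sgn-dot [] = sumW-[] _
  ∑-sgn-dot {suc n} (false ∷ c) = begin
      sumW (suc n) (λ x → sgn (dot (false ∷ c) x))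
    ≡⟨ sumW-∷ n _ ⟩
      sumW n (λ x → sgn (dot c x)) + sumW n (λ x → sgn (dot c x))
    ≡⟨ cong₂ _+_ (∑-sgn-dot c) (∑-sgn-dot c) ⟩
      ind (wt c ℕ.≡ᵇ 0) * (+ 2) ^ n + ind (wt c ℕ.≡ᵇ 0) * (+ 2) ^ n
    ≡⟨ doubling (ind (wt c ℕ.≡ᵇ 0)) ((+ 2) ^ n) ⟩
      ind (wt c ℕ.≡ᵇ 0) * (+ 2 * (+ 2) ^ n)
    ∎
    where
    doubling : ∀ a b → a * b + a * b ≡ a * (+ 2 * b)
    doubling = solve-∀
  ∑-sgn-dot {suc n} (true ∷ c) = begin
      sumW (suc n) (λ x → sgn (dot (true ∷ c) x))
    ≡⟨ sumW-∷ n _ ⟩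
      sumW n (λ x → sgn (dot c x)) + sumW n (λ x → sgn (not (dot c x)))
    ≡⟨ cong (λ s → sumW n (λ x → sgn (dot c x)) + s) (trans (sumW-cong n (λ x → sgn-not (dot c x))) (sumW-neg n _)) ⟩
      sumW n (λ x → sgn (dot c x)) - sumW n (λ x → sgn (dot c x))
    ≡⟨ ℤ.+-inverseʳ (sumW n (λ x → sgn (dot c x))) ⟩
      + 0
    ∎

  K : (n k : ℕ) → Word n → ℤ
  K n k c = sumW n (λ x → ind (wt x ℕ.≡ᵇ k) * sgn (dot c x))

  K-zero : ∀ n (c : Word n) → K n 0 c ≡ + 1
  K-zero zero [] = sumW-[] _
  K-zero (suc n) (false ∷ c) = trans (sumW-∷ n _) (cong₂ _+_ (K-zero n c) (sumW-0 n))
  K-zero (suc n) (true ∷ c) = trans (sumW-∷ n _) (cong₂ _+_ (K-zero n c) (sumW-0 n))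

  K-suc-false : ∀ n k (c : Word n) → K (suc n) (suc k) (false ∷ c) ≡ K n (suc k) c + K n k c
  K-suc-false n k c = sumW-∷ n _

  K-suc-true : ∀ n k (c : Word n) → K (suc n) (suc k) (true ∷ c) ≡ K n (suc k) c - K n k c
  K-suc-true n k c =
    trans (sumW-∷ n _) (cong (λ s → K n (suc k) c + s) (trans (sumW-cong n flip) (sumW-neg n _)))
    where
    flip : ∀ x → ind (wt x ℕ.≡ᵇ k) * sgn (not (dot c x)) ≡ - (ind (wt x ℕ.≡ᵇ k) * sgn (dot c x))
    flip x = trans (cong (ind (wt x ℕ.≡ᵇ k) *_) (sgn-not (dot c x))) (sym (ℤ.neg-distribʳ-* (ind (wt x ℕ.≡ᵇ k)) (sgn (dot c x))))

  balance : ∀ {n} → Word n → ℤ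
  balance {n} c = + n - + 2 * + wt c

  balance-false : ∀ {n} (c : Word n) → balance (false ∷ c) ≡ balance c + + 1
  balance-false {n} c = shift (+ n) (+ wt c)
    where
    shift : ∀ N W → (+ 1 + N) - + 2 * W ≡ (N - + 2 * W) + + 1
    shift = solve-∀

  balance-true : ∀ {n} (c : Word n) → balance (true ∷ c) ≡ balance c - + 1
  balance-true {n} c = shift (+ n) (+ wt c)
    where
    shift : ∀ N W → (+ 1 + N) - + 2 * (+ 1 + W) ≡ (N - + 2 * W) - + 1
    shift = solve-∀

  K-one : ∀ n (c : Word n) → K n 1 c ≡ balance c
  K-one zero [] = sumW-[] _
  K-one (suc n) (false ∷ c) =
    trans (K-suc-false n 0 c) (trans (cong₂ _+_ (K-one n c) (K-zero n c)) (sym (balance-false c)))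
  K-one (suc n) (true ∷ c) =
    trans (K-suc-true n 0 c) (trans (cong₂ _-_ (K-one n c) (K-zero n c)) (sym (balance-true c)))

  K-two : ∀ n (c : Word n) → + 2 * K n 2 c ≡ balance c * balance c - + n
  K-two zero [] = cong (+ 2 *_) (sumW-[] _)
  K-two (suc n) (false ∷ c) = begin
      + 2 * K (suc n) 2 (false ∷ c)
    ≡⟨ cong (+ 2 *_) (K-suc-false n 1 c) ⟩
      + 2 * (K n 2 c + K n 1 c)
    ≡⟨ ℤ.*-distribˡ-+ (+ 2) (K n 2 c) (K n 1 c) ⟩
      + 2 * K n 2 c + + 2 * K n 1 c
    ≡⟨ cong₂ (λ a b → a + + 2 * b) (K-two n c) (K-one n c) ⟩
      (balance c * balance c - + n) + + 2 * balance c
    ≡⟨ step (balance c) (+ n) ⟩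
      (balance c + + 1) * (balance c + + 1) - (+ 1 + + n)
    ≡⟨ cong (λ b → b * b - + suc n) (sym (balance-false c)) ⟩
      balance (false ∷ c) * balance (false ∷ c) - + suc n
    ∎
    where
    step : ∀ x N → (x * x - N) + + 2 * x ≡ (x + + 1) * (x + + 1) - (+ 1 + N)
    step = solve-∀
  K-two (suc n) (true ∷ c) = begin
      + 2 * K (suc n) 2 (true ∷ c)
    ≡⟨ cong (+ 2 *_) (K-suc-true n 1 c) ⟩
      + 2 * (K n 2 c - K n 1 c)
    ≡⟨ distrib (K n 2 c) (K n 1 c) ⟩
      + 2 * K n 2 c - + 2 * K n 1 c
    ≡⟨ cong₂ (λ a b → a - + 2 * b) (K-two n c) (K-one n c) ⟩
      (balance c * balance c - + n) - + 2 * balance c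
    ≡⟨ step (balance c) (+ n) ⟩
      (balance c - + 1) * (balance c - + 1) - (+ 1 + + n)
    ≡⟨ cong (λ b → b * b - + suc n) (sym (balance-true c)) ⟩
      balance (true ∷ c) * balance (true ∷ c) - + suc n
    ∎
    where
    distrib : ∀ a b → + 2 * (a - b) ≡ + 2 * a - + 2 * b
    distrib = solve-∀
    step : ∀ x N → (x * x - N) - + 2 * x ≡ (x - + 1) * (x - + 1) - (+ 1 + N)
    step = solve-∀

  K-three : ∀ n (c : Word n) → + 6 * K n 3 c ≡ balance c * balance c * balance c - (+ 3 * + n - + 2) * balance c
  K-three zero [] = cong (+ 6 *_) (sumW-[] _)
  K-three (suc n) (false ∷ c) = begin
      + 6 * K (suc n) 3 (false ∷ c)
    ≡⟨ cong (+ 6 *_) (K-suc-false n 2 c) ⟩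
      + 6 * (K n 3 c + K n 2 c)
    ≡⟨ distrib (K n 3 c) (K n 2 c) ⟩
      + 6 * K n 3 c + + 3 * (+ 2 * K n 2 c)
    ≡⟨ cong₂ (λ a b → a + + 3 * b) (K-three n c) (K-two n c) ⟩
      (balance c * balance c * balance c - (+ 3 * + n - + 2) * balance c) + + 3 * (balance c * balance c - + n)
    ≡⟨ step (balance c) (+ n) ⟩
      (balance c + + 1) * (balance c + + 1) * (balance c + + 1) - (+ 3 * (+ 1 + + n) - + 2) * (balance c + + 1)
    ≡⟨ cong (λ b → b * b * b - (+ 3 * + suc n - + 2) * b) (sym (balance-false c)) ⟩
      balance (false ∷ c) * balance (false ∷ c) * balance (false ∷ c) - (+ 3 * + suc n - + 2) * balance (false ∷ c)
    ∎
    where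
    distrib : ∀ a b → + 6 * (a + b) ≡ + 6 * a + + 3 * (+ 2 * b)
    distrib = solve-∀
    step : ∀ x N → (x * x * x - (+ 3 * N - + 2) * x) + + 3 * (x * x - N)
                 ≡ (x + + 1) * (x + + 1) * (x + + 1) - (+ 3 * (+ 1 + N) - + 2) * (x + + 1)
    step = solve-∀
  K-three (suc n) (true ∷ c) = begin
      + 6 * K (suc n) 3 (true ∷ c)
    ≡⟨ cong (+ 6 *_) (K-suc-true n 2 c) ⟩
      + 6 * (K n 3 c - K n 2 c)
    ≡⟨ distrib (K n 3 c) (K n 2 c) ⟩
      + 6 * K n 3 c - + 3 * (+ 2 * K n 2 c)
    ≡⟨ cong₂ (λ a b → a - + 3 * b) (K-three n c) (K-two n c) ⟩
      (balance c * balance c * balance c - (+ 3 * + n - + 2) * balance c) - + 3 * (balance c * balance c - + n)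
    ≡⟨ step (balance c) (+ n) ⟩
      (balance c - + 1) * (balance c - + 1) * (balance c - + 1) - (+ 3 * (+ 1 + + n) - + 2) * (balance c - + 1)
    ≡⟨ cong (λ b → b * b * b - (+ 3 * + suc n - + 2) * b) (sym (balance-true c)) ⟩
      balance (true ∷ c) * balance (true ∷ c) * balance (true ∷ c) - (+ 3 * + suc n - + 2) * balance (true ∷ c)
    ∎
    where
    distrib : ∀ a b → + 6 * (a - b) ≡ + 6 * a - + 3 * (+ 2 * b)
    distrib = solve-∀
    step : ∀ x N → (x * x * x - (+ 3 * N - + 2) * x) - + 3 * (x * x - N)
                 ≡ (x - + 1) * (x - + 1) * (x - + 1) - (+ 3 * (+ 1 + N) - + 2) * (x - + 1)
    step = solve-∀

  #tetrads : ∀ {n} → Code n → ℤ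
  #tetrads {n} C = sumW n (λ c → ind (isC4 C c))

  #tetradsAt : ∀ {n} → Code n → Fin n → ℤ
  #tetradsAt {n} C j = sumW n (λ c → ind (isC4 C c ∧ lookup c j))

  module SelfDualCode {n} (C : Code n) (linear : IsLinear C) (selfDual : SelfDual C) where

    zero∈C : C zeroW ≡ true
    zero∈C = proj₁ linear

    ⊕-closed : ∀ {x y} → C x ≡ true → C y ≡ true → C (x ⊕ y) ≡ true
    ⊕-closed = proj₂ linear _ _

    weight0∈C : ∀ c → (wt c ℕ.≡ᵇ 0) ≡ true → C c ≡ true
    weight0∈C c w≡0 = subst (λ z → C z ≡ true) (sym (wt≡ᵇ0⇒zeroW c w≡0)) zero∈C

    C-⊕ : ∀ {y} c → C y ≡ true → C (c ⊕ y) ≡ C c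
    C-⊕ {y} c y∈C = ≡true-ext
      (λ c⊕y∈C → subst (λ z → C z ≡ true) (⊕-cancelʳ c y) (⊕-closed c⊕y∈C y∈C))
      (λ c∈C → ⊕-closed c∈C y∈C)

    orthogonal : ∀ {x y} → C x ≡ true → C y ≡ true → dot x y ≡ false
    orthogonal x∈C y∈C = Equivalence.to (selfDual _) x∈C _ y∈C

    ones∈C : (∀ x → C x ≡ true → 2 ∣ wt x) → C ones ≡ true
    ones∈C even = Equivalence.from (selfDual ones) (λ y y∈C → trans (dot-onesˡ y) (parity-even _ (even y y∈C)))

    size : ℤ
    size = sumW n (λ c → ind (C c))

    character : Word n → ℤ
    character z = sumW n (λ c → ind (C c) * sgn (dot c z))

    character-∈ : ∀ {z} → C z ≡ true → character z ≡ size
    character-∈ {z} z∈C = sumW-cong n pointwise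
      where
      pointwise : ∀ c → ind (C c) * sgn (dot c z) ≡ ind (C c)
      pointwise c with C c in c∈C
      ... | false = refl
      ... | true rewrite orthogonal c∈C z∈C = refl

    character-antisymmetric : ∀ {y} z → C y ≡ true → dot z y ≡ true → character z ≡ - character z
    character-antisymmetric {y} z y∈C zy≡1 =
      trans (sumW-⊕ n y _) (trans (sumW-cong n pointwise) (sumW-neg n _))
      where
      negate : ∀ a s → a * (s * - + 1) ≡ - (a * s)
      negate = solve-∀
      pointwise : ∀ c → ind (C (c ⊕ y)) * sgn (dot (c ⊕ y) z) ≡ - (ind (C c) * sgn (dot c z))
      pointwise c rewrite C-⊕ c y∈C | dot-⊕ˡ c y z | dot-comm y z | zy≡1 | sgn-xor (dot c z) true =
        negate (ind (C c)) (sgn (dot c z))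

    character-∉ : ∀ {z} → C z ≡ false → character z ≡ + 0
    character-∉ {z} z∉C with character z ℤ.≟ + 0
    ... | yes vanishes = vanishes
    ... | no ≢0 = ⊥-elim (false≢true (trans (sym z∉C) (Equivalence.from (selfDual z) z∈dual)))
      where
      false≢true : false ≢ true
      false≢true ()
      z∈dual : InDual C z
      z∈dual y y∈C with dot z y in zy
      ... | false = refl
      ... | true = ⊥-elim (≢0 (self-negation _ (character-antisymmetric z y∈C zy)))

    character-sum : ∀ z → character z ≡ size * ind (C z)
    character-sum z with C z in z∈C
    ... | true = trans (character-∈ z∈C) (sym (ℤ.*-identityʳ size))
    ... | false = trans (character-∉ z∈C) (sym (ℤ.*-zeroʳ size))

    size-squared : size * size ≡ (+ 2) ^ n
    size-squared = begin
        size * size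
      ≡⟨ sym (sumW-* n size (λ x → ind (C x))) ⟩
        sumW n (λ x → size * ind (C x))
      ≡⟨ sym (sumW-cong n character-sum) ⟩
        sumW n (λ x → sumW n (λ c → ind (C c) * sgn (dot c x)))
      ≡⟨ sumW-swap n n (λ x c → ind (C c) * sgn (dot c x)) ⟩
        sumW n (λ c → sumW n (λ x → ind (C c) * sgn (dot c x)))
      ≡⟨ sumW-cong n (λ c → trans (sumW-* n (ind (C c)) (λ x → sgn (dot c x))) (cong (ind (C c) *_) (∑-sgn-dot c))) ⟩
        sumW n (λ c → ind (C c) * (ind (wt c ℕ.≡ᵇ 0) * (+ 2) ^ n))
      ≡⟨ sumW-cong n pointwise ⟩
        sumW n (λ c → (+ 2) ^ n * ind (wt c ℕ.≡ᵇ 0))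
      ≡⟨ sumW-* n ((+ 2) ^ n) (λ c → ind (wt c ℕ.≡ᵇ 0)) ⟩
        (+ 2) ^ n * sumW n (λ c → ind (wt c ℕ.≡ᵇ 0))
      ≡⟨ cong ((+ 2) ^ n *_) (∑-wt≡0 n) ⟩
        (+ 2) ^ n * + 1
      ≡⟨ ℤ.*-identityʳ _ ⟩
        (+ 2) ^ n
      ∎
      where
      pointwise : ∀ c → ind (C c) * (ind (wt c ℕ.≡ᵇ 0) * (+ 2) ^ n) ≡ (+ 2) ^ n * ind (wt c ℕ.≡ᵇ 0)
      pointwise c with wt c ℕ.≡ᵇ 0 in w≡0
      ... | false = trans (ℤ.*-zeroʳ (ind (C c))) (sym (ℤ.*-zeroʳ ((+ 2) ^ n)))
      ... | true rewrite weight0∈C c w≡0 = trans (ℤ.*-identityˡ _) (ℤ.*-comm (+ 1) _)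

    χ : Fin n → Word n → ℤ
    χ i c = ind (C c) * sgn (lookup c i)

    χ-⊕-ones : (∀ x → C x ≡ true → 2 ∣ wt x) → ∀ i c → χ i (c ⊕ ones) ≡ - χ i c
    χ-⊕-ones even i c rewrite C-⊕ c (ones∈C even) | lookup-⊕-ones c i | sgn-not (lookup c i) =
      sym (ℤ.neg-distribʳ-* (ind (C c)) (sgn (lookup c i)))

    ∑χK-duality : ∀ i k →
      sumW n (λ c → χ i c * K n k c) ≡ size * sumW n (λ x → ind (C x) * ind (wt (x ⊕ unit i) ℕ.≡ᵇ k))
    ∑χK-duality i k = begin
        sumW n (λ c → χ i c * K n k c)
      ≡⟨ sumW-cong n (λ c → sym (sumW-* n (χ i c) _)) ⟩
        sumW n (λ c → sumW n (λ x → χ i c * (δ x * sgn (dot c x))))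
      ≡⟨ sumW-swap n n _ ⟩
        sumW n (λ x → sumW n (λ c → χ i c * (δ x * sgn (dot c x))))
      ≡⟨ sumW-cong n (λ x → trans (sumW-cong n (regroup x)) (sumW-* n (δ x) _)) ⟩
        sumW n (λ x → δ x * character (unit i ⊕ x))
      ≡⟨ sumW-cong n (λ x → cong (δ x *_) (character-sum (unit i ⊕ x))) ⟩
        sumW n (λ x → δ x * (size * ind (C (unit i ⊕ x))))
      ≡⟨ sumW-⊕ n (unit i) _ ⟩
        sumW n (λ x → δ (x ⊕ unit i) * (size * ind (C (unit i ⊕ (x ⊕ unit i)))))
      ≡⟨ sumW-cong n untranslate ⟩
        sumW n (λ x → size * (ind (C x) * δ (x ⊕ unit i)))
      ≡⟨ sumW-* n size _ ⟩
        size * sumW n (λ x → ind (C x) * δ (x ⊕ unit i))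
      ∎
      where
      δ : Word n → ℤ
      δ x = ind (wt x ℕ.≡ᵇ k)
      rearrange₁ : ∀ a s d t → a * s * (d * t) ≡ d * (a * (s * t))
      rearrange₁ = solve-∀
      rearrange₂ : ∀ d m a → d * (m * a) ≡ m * (a * d)
      rearrange₂ = solve-∀
      regroup : ∀ x c → χ i c * (δ x * sgn (dot c x)) ≡ δ x * (ind (C c) * sgn (dot c (unit i ⊕ x)))
      regroup x c rewrite dot-unit-⊕ c x i | sgn-xor (lookup c i) (dot c x) =
        rearrange₁ (ind (C c)) (sgn (lookup c i)) (δ x) (sgn (dot c x))
      untranslate : ∀ x → δ (x ⊕ unit i) * (size * ind (C (unit i ⊕ (x ⊕ unit i)))) ≡ size * (ind (C x) * δ (x ⊕ unit i))
      untranslate x rewrite ⊕-comm (unit i) (x ⊕ unit i) | ⊕-cancelʳ x (unit i) =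
        rearrange₂ (δ (x ⊕ unit i)) size (ind (C x))

  module _ {n} (C : Code n) (noWeight2 : ∀ x → C x ≡ true → wt x ≢ 2) (i : Fin n) where

    ∑-distance-one : C zeroW ≡ true → sumW n (λ x → ind (C x) * ind (wt (x ⊕ unit i) ℕ.≡ᵇ 1)) ≡ + 1
    ∑-distance-one zero∈C = trans (sumW-cong n pointwise) (∑-wt≡0 n)
      where
      nonzero : ∀ x → C x ≡ false → ind (wt x ℕ.≡ᵇ 0) ≡ + 0
      nonzero x x∉C with wt x ℕ.≡ᵇ 0 in w≡0
      ... | false = refl
      ... | true with () ← trans (sym x∉C) (subst (λ z → C z ≡ true) (sym (wt≡ᵇ0⇒zeroW x w≡0)) zero∈C)
      pointwise : ∀ x → ind (C x) * ind (wt (x ⊕ unit i) ℕ.≡ᵇ 1) ≡ ind (wt x ℕ.≡ᵇ 0)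
      pointwise x with C x in x∈C
      ... | false = sym (nonzero x x∈C)
      ... | true with wt-⊕-unit x i
      ...   | inj₂ (_ , w≡) rewrite w≡ = ℤ.*-identityˡ _
      ...   | inj₁ (_ , w≡) rewrite w≡
                             | ≢⇒≡ᵇ-false (wt (x ⊕ unit i)) 1 (λ w≡1 → noWeight2 x x∈C (trans w≡ (cong suc w≡1))) = refl

    ∑-distance-three : sumW n (λ x → ind (C x) * ind (wt (x ⊕ unit i) ℕ.≡ᵇ 3)) ≡ #tetradsAt C i
    ∑-distance-three = sumW-cong n pointwise
      where
      pointwise : ∀ x → ind (C x) * ind (wt (x ⊕ unit i) ℕ.≡ᵇ 3) ≡ ind (isC4 C x ∧ lookup x i)
      pointwise x with C x in x∈C
      ... | false = refl
      ... | true with wt-⊕-unit x i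
      ...   | inj₁ (xᵢ , w≡) rewrite xᵢ | w≡ = trans (ℤ.*-identityˡ _) (cong ind (sym (∧-identityʳ _)))
      ...   | inj₂ (xᵢ , w≡) rewrite xᵢ | w≡ | ≢⇒≡ᵇ-false (wt x) 2 (noWeight2 x x∈C) | ∧-zeroʳ (wt x ℕ.≡ᵇ 4) = refl

  isC4⇒wt≡4 : ∀ {n} (C : Code n) c → isC4 C c ≡ true → wt c ≡ 4
  isC4⇒wt≡4 C c c∈C₄ = ℕ.≡ᵇ⇒≡ (wt c) 4 (Equivalence.from T-≡ (proj₂ (∧-true c∈C₄)))

  module Component {n} (C : Code n) (linear : IsLinear C) (S : Vec Bool n) (component : IsComponentClass C S) where

    tetrad-meeting-S-lies-in-S : ∀ {c} → isC4 C c ≡ true → ∀ {j} → lookup S j ≡ true → lookup c j ≡ true →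
                                 ∀ k → lookup c k ≡ true → lookup S k ≡ true
    tetrad-meeting-S-lies-in-S c∈C₄ Sⱼ cⱼ k cₖ =
      Equivalence.from (class k) (Equivalence.to (class _) Sⱼ ◅◅ (fwd (_ , c∈C₄ , cⱼ , cₖ) ◅ ε))
      where
      class : ∀ j → (lookup S j ≡ true) ⇔ EqClosure (Adj C) (proj₁ component) j
      class = proj₂ (proj₂ component)

    tetrad-inside-or-outside : ∀ c → isC4 C c ≡ true → restrict S c ≡ zeroW ⊎ restrict S c ≡ c
    tetrad-inside-or-outside c c∈C₄ with restrict-disjoint-or-meets S c
    ... | inj₁ disjoint = inj₁ disjoint
    ... | inj₂ (j , Sⱼ , cⱼ) = inj₂ (restrict-⊆ S c (tetrad-meeting-S-lies-in-S c∈C₄ Sⱼ cⱼ))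

    restrict-tetrad∈C : ∀ g → isC4 C g ≡ true → C (restrict S g) ≡ true
    restrict-tetrad∈C g g∈C₄ with tetrad-inside-or-outside g g∈C₄
    ... | inj₁ outside = subst (λ z → C z ≡ true) (sym outside) (proj₁ linear)
    ... | inj₂ inside = subst (λ z → C z ≡ true) (sym inside) (proj₁ (∧-true g∈C₄))

    component⇒ : ∀ w → inComp C S w ≡ true → C w ≡ true × restrict S w ≡ w
    component⇒ w w∈D with anyL⁻ _ (allWords n) w∈D
    ... | c , _ , c∈τ∧ with ∧-true c∈τ∧
    ...   | c∈τ , projection with anyL⁻ _ (spanL (C4list C)) c∈τ
    ...     | v , v∈span , c≡v =
      subst (λ z → C z ≡ true × restrict S z ≡ z) w≡
        (restrict-span C linear S (C4list C) (λ g g∈ → restrict-tetrad∈C g (filterL⁻ (isC4 C) (allWords n) g∈)) v v∈span ,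
         restrict-idem S v)
      where
      w≡ : restrict S v ≡ w
      w≡ = trans (cong (restrict S) (sym (eqW⇒≡ c v c≡v))) (eqW⇒≡ (restrict S c) w projection)

    component⇐ : ∀ w → isC4 C w ≡ true → eqW (restrict S w) w ≡ true → inComp C S w ≡ true
    component⇐ w w∈C₄ inside =
      anyL⁺ _ (allWords n) (allWords-complete w) (cong₂ _∧_ w∈τ inside)
      where
      w∈τ : inTau C w ≡ true
      w∈τ = anyL⁺ (eqW w) (spanL (C4list C))
              (∈⇒∈span (C4list C) (filterL⁺ (isC4 C) (allWords n) (allWords-complete w) w∈C₄)) (eqW-refl w)

    component-tetrad≡ : ∀ w → (inComp C S w ∧ (wt w ℕ.≡ᵇ 4)) ≡ (isC4 C w ∧ eqW (restrict S w) w)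
    component-tetrad≡ w = ≡true-ext to from
      where
      to : inComp C S w ∧ (wt w ℕ.≡ᵇ 4) ≡ true → isC4 C w ∧ eqW (restrict S w) w ≡ true
      to w∈D₄ with ∧-true w∈D₄
      ... | w∈D , wt≡4 with component⇒ w w∈D
      ...   | w∈C , inside = cong₂ _∧_ (cong₂ _∧_ w∈C wt≡4) (trans (cong (λ z → eqW z w) inside) (eqW-refl w))
      from : isC4 C w ∧ eqW (restrict S w) w ≡ true → inComp C S w ∧ (wt w ℕ.≡ᵇ 4) ≡ true
      from w∈C₄∧inside with ∧-true w∈C₄∧inside
      ... | w∈C₄ , inside = cong₂ _∧_ (component⇐ w w∈C₄ inside) (proj₂ (∧-true w∈C₄))

    #componentTetrads : ℤ
    #componentTetrads = sumW n (λ c → ind (isC4 C c ∧ eqW (restrict S c) c))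

    numComp4≡#componentTetrads : + numComp4 C S ≡ #componentTetrads
    numComp4≡#componentTetrads =
      trans (cong +_ (countL-cong component-tetrad≡ (allWords n))) (sumW-count n _)

    tetrad-weight-in-S : ∀ c → ind (isC4 C c) * + wt (restrict S c) ≡ + 4 * ind (isC4 C c ∧ eqW (restrict S c) c)
    tetrad-weight-in-S c with isC4 C c in c∈C₄
    ... | false = refl
    ... | true with tetrad-inside-or-outside c c∈C₄
    ...   | inj₂ inside rewrite inside | eqW-refl c | isC4⇒wt≡4 C c c∈C₄ = refl
    ...   | inj₁ outside rewrite outside | wt-zeroW n | eqW-zeroW c (cong (ℕ._≡ᵇ 0) (isC4⇒wt≡4 C c c∈C₄)) = refl

    ∑-tetradsAt-S : sum (λ j → ind (lookup S j) * #tetradsAt C j) ≡ + 4 * #componentTetrads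
    ∑-tetradsAt-S = begin
        sum (λ j → ind (lookup S j) * #tetradsAt C j)
      ≡⟨ sum-cong-≗ (λ j → sym (sumW-* n (ind (lookup S j)) _)) ⟩
        sum (λ j → sumW n (λ c → ind (lookup S j) * ind (isC4 C c ∧ lookup c j)))
      ≡⟨ sym (sumW-∑ n n (λ c j → ind (lookup S j) * ind (isC4 C c ∧ lookup c j))) ⟩
        sumW n (λ c → sum (λ j → ind (lookup S j) * ind (isC4 C c ∧ lookup c j)))
      ≡⟨ sumW-cong n (λ c → sum-cong-≗ (regroup c)) ⟩
        sumW n (λ c → sum (λ j → ind (isC4 C c) * ind (lookup (restrict S c) j)))
      ≡⟨ sumW-cong n (λ c → trans (sym (*-distribˡ-sum (ind (isC4 C c)) (λ j → ind (lookup (restrict S c) j)))) (cong (ind (isC4 C c) *_) (∑-ind-lookup (restrict S c)))) ⟩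
        sumW n (λ c → ind (isC4 C c) * + wt (restrict S c))
      ≡⟨ sumW-cong n tetrad-weight-in-S ⟩
        sumW n (λ c → + 4 * ind (isC4 C c ∧ eqW (restrict S c) c))
      ≡⟨ sumW-* n (+ 4) _ ⟩
        + 4 * #componentTetrads
      ∎
      where
      rearrange : ∀ s t l → s * (t * l) ≡ t * (s * l)
      rearrange = solve-∀
      regroup : ∀ c j → ind (lookup S j) * ind (isC4 C c ∧ lookup c j) ≡ ind (isC4 C c) * ind (lookup (restrict S c) j)
      regroup c j = begin
          ind (lookup S j) * ind (isC4 C c ∧ lookup c j)
        ≡⟨ cong (ind (lookup S j) *_) (ind-∧ (isC4 C c) (lookup c j)) ⟩
          ind (lookup S j) * (ind (isC4 C c) * ind (lookup c j))
        ≡⟨ rearrange (ind (lookup S j)) (ind (isC4 C c)) (ind (lookup c j)) ⟩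
          ind (isC4 C c) * (ind (lookup S j) * ind (lookup c j))
        ≡⟨ cong (ind (isC4 C c) *_) (sym (trans (cong ind (lookup-zipWith _∧_ j S c)) (ind-∧ (lookup S j) (lookup c j)))) ⟩
          ind (isC4 C c) * ind (lookup (restrict S c) j)
        ∎

    component-count : ∀ N → (∀ j → #tetradsAt C j ≡ N) → + 4 * #componentTetrads ≡ + wt S * N
    component-count N regular = begin
        + 4 * #componentTetrads
      ≡⟨ sym ∑-tetradsAt-S ⟩
        sum (λ j → ind (lookup S j) * #tetradsAt C j)
      ≡⟨ sum-cong-≗ (λ j → cong (ind (lookup S j) *_) (regular j)) ⟩
        sum (λ j → ind (lookup S j) * N)
      ≡⟨ sym (*-distribʳ-sum N (λ j → ind (lookup S j))) ⟩
        sum (λ j → ind (lookup S j)) * N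
      ≡⟨ cong (_* N) (∑-ind-lookup S) ⟩
        + wt S * N
      ∎

  module TypeII₂₄ (C : Code 24) (typeII : IsTypeII C) where

    linear : IsLinear C
    linear = proj₁ typeII

    open SelfDualCode C linear (proj₁ (proj₂ typeII))

    doublyEven : ∀ x → C x ≡ true → 4 ∣ wt x
    doublyEven = proj₂ (proj₂ typeII)

    even : ∀ x → C x ≡ true → 2 ∣ wt x
    even x x∈C = ∣-trans (divides 2 refl) (doublyEven x x∈C)

    noWeight2 : ∀ x → C x ≡ true → wt x ≢ 2
    noWeight2 x x∈C w≡2 with ∣⇒≤ (subst (4 ∣_) w≡2 (doublyEven x x∈C))
    ... | s≤s (s≤s ())

    size≡2¹² : size ≡ + 4096
    size≡2¹² = trans (sym count≡size) (cong +_ (square-injective m 4096 (ℤ.+-injective m²≡2²⁴)))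
      where
      m : ℕ
      m = countL C (allWords 24)
      count≡size : + m ≡ size
      count≡size = sumW-count 24 C
      m²≡2²⁴ : + (m ℕ.* m) ≡ + (4096 ℕ.* 4096)
      m²≡2²⁴ = trans (ℤ.pos-* m m) (trans (cong₂ _*_ count≡size count≡size) size-squared)

    cubic : ℤ → ℤ
    cubic x = x * (x - + 8) * (x + + 8)

    cubic-K : ∀ c → cubic (balance c) ≡ + 6 * (K 24 1 c + K 24 3 c)
    cubic-K c = begin
        cubic (balance c)
      ≡⟨ expand (balance c) ⟩
        + 6 * balance c + (balance c * balance c * balance c - (+ 3 * + 24 - + 2) * balance c)
      ≡⟨ sym (cong₂ (λ a b → + 6 * a + b) (K-one 24 c) (K-three 24 c)) ⟩
        + 6 * K 24 1 c + + 6 * K 24 3 c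
      ≡⟨ sym (ℤ.*-distribˡ-+ (+ 6) (K 24 1 c) (K 24 3 c)) ⟩
        + 6 * (K 24 1 c + K 24 3 c)
      ∎
      where
      expand : ∀ x → x * (x - + 8) * (x + + 8) ≡ + 6 * x + (x * x * x - (+ 3 * + 24 - + 2) * x)
      expand = solve-∀

    cubicHead : ℕ → ℤ
    cubicHead w = ind (w ℕ.≡ᵇ 0) * + 12288 + ind (w ℕ.≡ᵇ 4) * + 3072

    -- On doubly even weights the cubic vanishes at 8, 12, 16 and is odd under w ↦ 24 - w;
    -- cubicHead keeps its values 12288 and 3072 at w = 0 and w = 4.
    cubic-doublyEven : ∀ q → q ℕ.* 4 ≤ 24 →
      cubic (+ 24 - + 2 * + (q ℕ.* 4)) ≡ cubicHead (q ℕ.* 4) - cubicHead (24 ∸ q ℕ.* 4)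
    cubic-doublyEven 0 _ = refl
    cubic-doublyEven 1 _ = refl
    cubic-doublyEven 2 _ = refl
    cubic-doublyEven 3 _ = refl
    cubic-doublyEven 4 _ = refl
    cubic-doublyEven 5 _ = refl
    cubic-doublyEven 6 _ = refl
    cubic-doublyEven (suc (suc (suc (suc (suc (suc (suc q))))))) 28+4q≤24 =
      ⊥-elim (ℕ.<-irrefl refl (ℕ.m+n≤o⇒m≤o 25 28+4q≤24))

    module _ (i : Fin 24) where

      χ-∉ : ∀ {c} → C c ≡ false → χ i c ≡ + 0
      χ-∉ {c} c∉C = cong (λ b → ind b * sgn (lookup c i)) c∉C

      ∑χ-cubic-transform : sumW 24 (λ c → χ i c * cubic (balance c)) ≡ + 6 * (size * (+ 1 + #tetradsAt C i))
      ∑χ-cubic-transform = begin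
          sumW 24 (λ c → χ i c * cubic (balance c))
        ≡⟨ sumW-cong 24 (λ c → trans (cong (χ i c *_) (cubic-K c)) (regroup (χ i c) (K 24 1 c) (K 24 3 c))) ⟩
          sumW 24 (λ c → + 6 * (χ i c * K 24 1 c + χ i c * K 24 3 c))
        ≡⟨ trans (sumW-* 24 (+ 6) (λ c → χ i c * K 24 1 c + χ i c * K 24 3 c))
                 (cong (+ 6 *_) (sumW-+ 24 (λ c → χ i c * K 24 1 c) (λ c → χ i c * K 24 3 c))) ⟩
          + 6 * (sumW 24 (λ c → χ i c * K 24 1 c) + sumW 24 (λ c → χ i c * K 24 3 c))
        ≡⟨ cong (+ 6 *_) (cong₂ _+_ (∑χK-duality i 1) (∑χK-duality i 3)) ⟩
          + 6 * (size * sumW 24 (λ x → ind (C x) * ind (wt (x ⊕ unit i) ℕ.≡ᵇ 1))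
                + size * sumW 24 (λ x → ind (C x) * ind (wt (x ⊕ unit i) ℕ.≡ᵇ 3)))
        ≡⟨ cong (+ 6 *_) (cong₂ (λ a b → size * a + size * b) (∑-distance-one C noWeight2 i zero∈C) (∑-distance-three C noWeight2 i)) ⟩
          + 6 * (size * + 1 + size * #tetradsAt C i)
        ≡⟨ cong (+ 6 *_) (sym (ℤ.*-distribˡ-+ size (+ 1) (#tetradsAt C i))) ⟩
          + 6 * (size * (+ 1 + #tetradsAt C i))
        ∎
        where
        regroup : ∀ p k₁ k₃ → p * (+ 6 * (k₁ + k₃)) ≡ + 6 * (p * k₁ + p * k₃)
        regroup = solve-∀

      ∑χ-cubic-fold : sumW 24 (λ c → χ i c * cubic (balance c)) ≡ + 2 * sumW 24 (λ c → χ i c * cubicHead (wt c))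
      ∑χ-cubic-fold = begin
          sumW 24 (λ c → χ i c * cubic (balance c))
        ≡⟨ sumW-cong 24 split ⟩
          sumW 24 (λ c → χ i c * cubicHead (wt c) - χ i c * cubicHead (24 ∸ wt c))
        ≡⟨ sumW-- 24 (λ c → χ i c * cubicHead (wt c)) (λ c → χ i c * cubicHead (24 ∸ wt c)) ⟩
          Σhead - sumW 24 (λ c → χ i c * cubicHead (24 ∸ wt c))
        ≡⟨ cong (λ s → Σhead - s) mirror ⟩
          Σhead - - Σhead
        ≡⟨ double Σhead ⟩
          + 2 * Σhead
        ∎
        where
        Σhead : ℤ
        Σhead = sumW 24 (λ c → χ i c * cubicHead (wt c))
        double : ∀ s → s - - s ≡ + 2 * s
        double = solve-∀
        distrib : ∀ p a b → p * (a - b) ≡ p * a - p * b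
        distrib = solve-∀
        split : ∀ c → χ i c * cubic (balance c) ≡ χ i c * cubicHead (wt c) - χ i c * cubicHead (24 ∸ wt c)
        split c = by-membership (C c) refl
          where
          by-membership : ∀ b → C c ≡ b → χ i c * cubic (balance c) ≡ χ i c * cubicHead (wt c) - χ i c * cubicHead (24 ∸ wt c)
          by-membership false c∉C rewrite χ-∉ c∉C = refl
          by-membership true c∈C with doublyEven c c∈C
          ... | divides q w≡4q =
            trans (cong (χ i c *_) (subst (λ w → cubic (+ 24 - + 2 * + w) ≡ cubicHead w - cubicHead (24 ∸ w)) (sym w≡4q)
                                           (cubic-doublyEven q (subst (_≤ 24) w≡4q (wt≤n c)))))
                  (distrib (χ i c) (cubicHead (wt c)) (cubicHead (24 ∸ wt c)))
        reflect : ∀ c → χ i (c ⊕ ones) * cubicHead (24 ∸ wt (c ⊕ ones)) ≡ - (χ i c * cubicHead (wt c))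
        reflect c rewrite χ-⊕-ones even i c | wt-⊕-ones c | ℕ.m∸[m∸n]≡n (wt≤n c) =
          sym (ℤ.neg-distribˡ-* (χ i c) (cubicHead (wt c)))
        mirror : sumW 24 (λ c → χ i c * cubicHead (24 ∸ wt c)) ≡ - Σhead
        mirror = trans (sumW-⊕ 24 ones _) (trans (sumW-cong 24 reflect) (sumW-neg 24 (λ c → χ i c * cubicHead (wt c))))

      ∑χ-cubicHead : sumW 24 (λ c → χ i c * cubicHead (wt c)) ≡ + 12288 + + 3072 * (#tetrads C - + 2 * #tetradsAt C i)
      ∑χ-cubicHead = begin
          sumW 24 (λ c → χ i c * cubicHead (wt c))
        ≡⟨ sumW-cong 24 pointwise ⟩
          sumW 24 (λ c → + 12288 * ind (wt c ℕ.≡ᵇ 0) + + 3072 * tetradSign c)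
        ≡⟨ sumW-+ 24 (λ c → + 12288 * ind (wt c ℕ.≡ᵇ 0)) (λ c → + 3072 * tetradSign c) ⟩
          sumW 24 (λ c → + 12288 * ind (wt c ℕ.≡ᵇ 0)) + sumW 24 (λ c → + 3072 * tetradSign c)
        ≡⟨ cong₂ _+_ (sumW-* 24 (+ 12288) (λ c → ind (wt c ℕ.≡ᵇ 0))) (sumW-* 24 (+ 3072) tetradSign) ⟩
          + 12288 * sumW 24 (λ c → ind (wt c ℕ.≡ᵇ 0)) + + 3072 * sumW 24 tetradSign
        ≡⟨ cong₂ (λ a b → + 12288 * a + + 3072 * b) (∑-wt≡0 24) ∑tetradSign ⟩
          + 12288 + + 3072 * (#tetrads C - + 2 * #tetradsAt C i)
        ∎
        where
        tetradSign : Word 24 → ℤ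
        tetradSign c = ind (isC4 C c) - + 2 * ind (isC4 C c ∧ lookup c i)
        ∑tetradSign : sumW 24 tetradSign ≡ #tetrads C - + 2 * #tetradsAt C i
        ∑tetradSign = trans (sumW-- 24 (λ c → ind (isC4 C c)) (λ c → + 2 * ind (isC4 C c ∧ lookup c i)))
                            (cong (λ s → #tetrads C - s) (sumW-* 24 (+ 2) (λ c → ind (isC4 C c ∧ lookup c i))))
        weight0 : ∀ c → ind (wt c ℕ.≡ᵇ 0) * χ i c ≡ ind (wt c ℕ.≡ᵇ 0)
        weight0 c with wt c ℕ.≡ᵇ 0 in w≡0
        ... | false = refl
        ... | true rewrite wt≡ᵇ0⇒zeroW c w≡0 = cong₂ (λ a b → + 1 * (ind a * sgn b)) zero∈C (lookup-zeroW i)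
        weight4 : ∀ t b s → ind t * (ind b * sgn s) ≡ ind (b ∧ t) - + 2 * ind ((b ∧ t) ∧ s)
        weight4 false false _ = refl
        weight4 false true _ = refl
        weight4 true false _ = refl
        weight4 true true true = refl
        weight4 true true false = refl
        expand : ∀ p a b → p * (a * + 12288 + b * + 3072) ≡ + 12288 * (a * p) + + 3072 * (b * p)
        expand = solve-∀
        pointwise : ∀ c → χ i c * cubicHead (wt c) ≡ + 12288 * ind (wt c ℕ.≡ᵇ 0) + + 3072 * tetradSign c
        pointwise c =
          trans (expand (χ i c) (ind (wt c ℕ.≡ᵇ 0)) (ind (wt c ℕ.≡ᵇ 4)))
                (cong₂ (λ a b → + 12288 * a + + 3072 * b) (weight0 c) (weight4 (wt c ℕ.≡ᵇ 4) (C c) (lookup c i)))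

    tetrads-design : ∀ i → #tetrads C ≡ + 6 * #tetradsAt C i
    tetrads-design i = linear-solution (#tetrads C) (#tetradsAt C i) (begin
        + 6 * (+ 4096 * (+ 1 + #tetradsAt C i))
      ≡⟨ cong (λ m → + 6 * (m * (+ 1 + #tetradsAt C i))) (sym size≡2¹²) ⟩
        + 6 * (size * (+ 1 + #tetradsAt C i))
      ≡⟨ sym (∑χ-cubic-transform i) ⟩
        sumW 24 (λ c → χ i c * cubic (balance c))
      ≡⟨ ∑χ-cubic-fold i ⟩
        + 2 * sumW 24 (λ c → χ i c * cubicHead (wt c))
      ≡⟨ cong (+ 2 *_) (∑χ-cubicHead i) ⟩
        + 2 * (+ 12288 + + 3072 * (#tetrads C - + 2 * #tetradsAt C i))
      ∎)
      where
      rearrange : ∀ A N → + 6144 * (A - + 6 * N) ≡ + 2 * (+ 12288 + + 3072 * (A - + 2 * N)) - + 6 * (+ 4096 * (+ 1 + N))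
      rearrange = solve-∀
      linear-solution : ∀ A N → + 6 * (+ 4096 * (+ 1 + N)) ≡ + 2 * (+ 12288 + + 3072 * (A - + 2 * N)) → A ≡ + 6 * N
      linear-solution A N eq = ℤ.i-j≡0⇒i≡j A (+ 6 * N) (ℤ.*-cancelˡ-≡ (+ 6144) (A - + 6 * N) (+ 0)
        (trans (rearrange A N) (trans (cong (λ l → l - + 6 * (+ 4096 * (+ 1 + N))) (sym eq)) (ℤ.+-inverseʳ (+ 6 * (+ 4096 * (+ 1 + N)))))))

    tetradsAt-regular : ∀ j → #tetradsAt C j ≡ #tetradsAt C zero
    tetradsAt-regular j = ℤ.*-cancelˡ-≡ (+ 6) (#tetradsAt C j) (#tetradsAt C zero) (trans (sym (tetrads-design j)) (tetrads-design zero))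

    tetrads-through-every-coordinate : numC4 C ≢ 0 → ∀ i → Σ (Word 24) λ c → isC4 C c ≡ true × lookup c i ≡ true
    tetrads-through-every-coordinate numC4≢0 i = proj₁ witness , ∧-true (proj₂ witness)
      where
      through≢0 : countL (λ c → isC4 C c ∧ lookup c i) (allWords 24) ≢ 0
      through≢0 none = numC4≢0 (ℤ.+-injective (begin
          + numC4 C
        ≡⟨ sumW-count 24 (isC4 C) ⟩
          #tetrads C
        ≡⟨ tetrads-design i ⟩
          + 6 * #tetradsAt C i
        ≡⟨ cong (+ 6 *_) (sym (sumW-count 24 (λ c → isC4 C c ∧ lookup c i))) ⟩
          + 6 * + countL (λ c → isC4 C c ∧ lookup c i) (allWords 24)
        ≡⟨ cong (λ m → + 6 * + m) none ⟩
          + 0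
        ∎))
      witness : Σ (Word 24) λ c → isC4 C c ∧ lookup c i ≡ true
      witness = countL≢0⇒witness (λ c → isC4 C c ∧ lookup c i) (allWords 24) through≢0

    component-tetrad-number : ∀ S → IsComponentClass C S → 24 ℕ.* numComp4 C S ≡ wt S ℕ.* numC4 C
    component-tetrad-number S component = ℤ.+-injective (begin
        + (24 ℕ.* numComp4 C S)
      ≡⟨ ℤ.pos-* 24 (numComp4 C S) ⟩
        + 24 * + numComp4 C S
      ≡⟨ cong (+ 24 *_) numComp4≡#componentTetrads ⟩
        + 24 * #componentTetrads
      ≡⟨ ℤ.*-assoc (+ 6) (+ 4) #componentTetrads ⟩
        + 6 * (+ 4 * #componentTetrads)
      ≡⟨ cong (+ 6 *_) (component-count (#tetradsAt C zero) tetradsAt-regular) ⟩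
        + 6 * (+ wt S * #tetradsAt C zero)
      ≡⟨ swap (+ wt S) (#tetradsAt C zero) ⟩
        + wt S * (+ 6 * #tetradsAt C zero)
      ≡⟨ cong (+ wt S *_) (sym (tetrads-design zero)) ⟩
        + wt S * #tetrads C
      ≡⟨ cong (+ wt S *_) (sym (sumW-count 24 (isC4 C))) ⟩
        + wt S * + numC4 C
      ≡⟨ sym (ℤ.pos-* (wt S) (numC4 C)) ⟩
        + (wt S ℕ.* numC4 C)
      ∎)
      where
      open Component C linear S component
      swap : ∀ w N → + 6 * (w * N) ≡ w * (+ 6 * N)
      swap = solve-∀

open import Data.Nat using (_*_)

proposition2p2 : (C : Code 24) → IsTypeII C →
    ((¬ Σ (Word 24) λ c → isC4 C c ≡ true)
      ⊎ (∀ (i : Fin 24) → Σ (Word 24) λ c → (isC4 C c ≡ true) × (lookup c i ≡ true)))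
    × (∀ (S : Vec Bool 24) → IsComponentClass C S → 24 * numComp4 C S ≡ wt S * numC4 C)
proposition2p2 C typeII = noTetrads-or-covering (numC4 C ℕ.≟ 0) , component-tetrad-number
  where
  open TypeII₂₄ C typeII
  -- Matching on the decision instead of using 'with' keeps Agda from normalising numC4 C,
  -- a count over all 2²⁴ words.
  noTetrads-or-covering : Dec (numC4 C ≡ 0) → (¬ Σ (Word 24) λ c → isC4 C c ≡ true)
    ⊎ (∀ (i : Fin 24) → Σ (Word 24) λ c → (isC4 C c ≡ true) × (lookup c i ≡ true))
  noTetrads-or-covering (yes none) = inj₁ (λ (c , c∈C₄) → countL≢0 (isC4 C) (allWords 24) (allWords-complete c) c∈C₄ none)
  noTetrads-or-covering (no some) = inj₂ (tetrads-through-every-coordinate some)
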